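{- Let $T$ be a tree with eigenvalue $\lambda$. Every straight set of eigenvectors of $T$ for $\lambda$ is linearly independent.
   Context: Eigenvalues and eigenvectors of a graph are those of its adjacency matrix; an eigenvector for $\lambda$ is a non-zero vector $x$ with $Ax=\lambda x$. $N_\lambda(T)$ is the set of vertices of $T$ on which every eigenvector of $T$ for $\lambda$ vanishes, and $T\setminus N_\lambda(T)$ is the graph obtained by deleting these vertices. A set $\{x_1,\ldots,x_r\}$ of eigenvectors of $T$ for $\lambda$ is straight if the connected components of $T\setminus N_\lambda(T)$ can be numbered $C_1,\ldots,C_s$ such that for $j=1,\ldots,r$ we have $x_j|_{C_j}\neq 0$ and $x_j|_{C_i}=0$ for $i=j+1,\ldots,r$. -}

module Defs where

import Level
open Level using (Level; _⊔_)
open import Algebra.Bundles using (CommutativeRing)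
open import Data.Nat using (ℕ; zero; suc; _≤_)
open import Data.Fin using (Fin; zero; suc; _<_; inject₁; fromℕ)
open import Data.Bool using (Bool; true; false; if_then_else_)
open import Data.Product using (Σ; ∃; ∃-syntax; _×_; _,_)
open import Relation.Binary.PropositionalEquality using (_≡_; _≢_)
open import Relation.Nullary using (¬_)
open import Relation.Binary.Construct.Closure.ReflexiveTransitive using (Star)

record Field (c ℓ : Level) : Set (Level.suc (c ⊔ ℓ)) where
  field
    commutativeRing : CommutativeRing c ℓ
  open CommutativeRing commutativeRing public
  field
    1≉0     : ¬ (1# ≈ 0#)
    inverse : ∀ x → ¬ (x ≈ 0#) → ∃[ y ] (x * y ≈ 1#)

record Graph (n : ℕ) : Set where
  field
    adj     : Fin n → Fin n → Bool
    sym     : ∀ v w → adj v w ≡ adj w v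
    irrefl  : ∀ v → adj v v ≡ false

module _ {n : ℕ} (G : Graph n) where
  open Graph G

  Adj : Fin n → Fin n → Set
  Adj v w = adj v w ≡ true

  Connected : Set
  Connected = ∀ v w → Star Adj v w

  HasCycle : Set
  HasCycle = Σ ℕ λ k → Σ (Fin (suc (suc (suc k))) → Fin n) λ f →
               (∀ i j → f i ≡ f j → i ≡ j)
             × (∀ (i : Fin (suc (suc k))) → Adj (f (inject₁ i)) (f (suc i)))
             × Adj (f (fromℕ (suc (suc k)))) (f zero)

  IsTree : Set
  IsTree = Connected × ¬ HasCycle

module _ {c ℓ} (K : Field c ℓ) where
  open Field K using (Carrier; _≈_; _+_; _*_; 0#; 1#)

  ∑ : ∀ {n} → (Fin n → Carrier) → Carrier
  ∑ {zero}  f = 0#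
  ∑ {suc n} f = f zero + ∑ (λ i → f (suc i))

  module _ {n : ℕ} (G : Graph n) where
    open Graph G

    adjMatrix : Fin n → Fin n → Carrier
    adjMatrix v w = if adj v w then 1# else 0#

    IsEigenvector : Carrier → (Fin n → Carrier) → Set ℓ
    IsEigenvector λ' x =
      (∃[ v ] ¬ (x v ≈ 0#)) ×
      (∀ v → ∑ (λ w → adjMatrix v w * x w) ≈ λ' * x v)

    IsEigenvalue : Carrier → Set (c ⊔ ℓ)
    IsEigenvalue λ' = ∃[ x ] IsEigenvector λ' x

    InN : Carrier → Fin n → Set (c ⊔ ℓ)
    InN λ' v = ∀ x → IsEigenvector λ' x → x v ≈ 0#

    AdjOut : Carrier → Fin n → Fin n → Set (c ⊔ ℓ)
    AdjOut λ' v w = (adj v w ≡ true) × ¬ InN λ' v × ¬ InN λ' w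

    InComponent : Carrier → Fin n → Fin n → Set (c ⊔ ℓ)
    InComponent λ' u v = ¬ InN λ' v × Star (AdjOut λ') u v

    -- A family x₁,…,x_r of eigenvectors for λ is straight if the
    -- components of G \ N_λ(G) can be numbered C₁,…,C_s so that
    -- x_j|C_j ≠ 0 and x_j|C_i = 0 for j < i ≤ r.  Only C₁,…,C_r matter;
    -- they are given by pairwise distinct components, each specified by
    -- a representative vertex rep j ∉ N_λ(G) (any injective numbering
    -- of r components extends to a numbering of all of them).
    IsStraight : Carrier → ∀ {r} → (Fin r → Fin n → Carrier) → Set (c ⊔ ℓ)
    IsStraight λ' {r} x =
      (∀ j → IsEigenvector λ' (x j)) ×
      Σ (Fin r → Fin n) λ rep →
          (∀ j → ¬ InN λ' (rep j))
        × (∀ i j → i ≢ j → ¬ Star (AdjOut λ') (rep i) (rep j))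
        × (∀ j → ∃[ v ] (InComponent λ' (rep j) v × ¬ (x j v ≈ 0#)))
        × (∀ j i → j < i → ∀ v → InComponent λ' (rep i) v → x j v ≈ 0#)

    LinearlyIndependent : ∀ {r} → (Fin r → Fin n → Carrier) → Set (c ⊔ ℓ)
    LinearlyIndependent {r} x =
      ∀ (a : Fin r → Carrier) →
        (∀ v → ∑ (λ j → a j * x j v) ≈ 0#) → ∀ j → a j ≈ 0#

-- A straight family is triangular: the vector x_j is non-zero at some vertex
-- of C_j, where every earlier x_i vanishes.  In a vanishing linear
-- combination, reading off that vertex shows a_j = 0 once a_i = 0 is known
-- for all i > j, so downward induction on j kills every coefficient.
module Submission where

open import Data.Nat using (ℕ)
open import Data.Fin as Fin using (Fin; _<_; _>_)
open import Data.Fin.Induction using (>-wellFounded)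
open import Data.Fin.Properties using (<-cmp; punchInᵢ≢i)
open import Data.Product using (∃-syntax; _×_; _,_)
open import Data.Vec.Functional using (removeAt)
open import Induction.WellFounded using (Acc; acc)
open import Relation.Binary.Definitions using (tri<; tri≈; tri>)
open import Relation.Binary.PropositionalEquality as ≡ using (_≡_; _≢_)
open import Relation.Nullary using (¬_)
open import Relation.Nullary.Negation using (contradiction)
open import Defs

module _ {c ℓ} (K : Field c ℓ) where
  open Field K hiding (zero)
  open import Algebra.Properties.CommutativeMonoid.Sum +-commutativeMonoid
    using (sum; sum-cong-≋; sum-replicate-zero; sum-remove)
  open import Relation.Binary.Reasoning.Setoid setoid

  ∑≡sum : ∀ {n} (f : Fin n → Carrier) → ∑ K f ≡ sum f
  ∑≡sum {ℕ.zero}  f = ≡.refl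
  ∑≡sum {ℕ.suc n} f = ≡.cong (f Fin.zero +_) (∑≡sum (λ i → f (Fin.suc i)))

  sum-zero : ∀ {n} (f : Fin n → Carrier) → (∀ i → f i ≈ 0#) → sum f ≈ 0#
  sum-zero {n} f f≈0 = trans (sum-cong-≋ f≈0) (sum-replicate-zero n)

  ∑-single : ∀ {n} (f : Fin n → Carrier) (j : Fin n) →
             (∀ i → i ≢ j → f i ≈ 0#) → ∑ K f ≈ f j
  ∑-single {ℕ.suc n} f j f≈0 = begin
    ∑ K f                    ≡⟨ ∑≡sum f ⟩
    sum f                    ≈⟨ sum-remove f ⟩
    f j + sum (removeAt f j) ≈⟨ +-congˡ (sum-zero _ (λ i → f≈0 _ (punchInᵢ≢i j i))) ⟩
    f j + 0#                 ≈⟨ +-identityʳ (f j) ⟩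
    f j                      ∎

  *-cancelʳ-nonzero : ∀ a y → a * y ≈ 0# → ¬ (y ≈ 0#) → a ≈ 0#
  *-cancelʳ-nonzero a y ay≈0 y≉0 with inverse y y≉0
  ... | y⁻¹ , yy⁻¹≈1 = begin
    a              ≈⟨ sym (*-identityʳ a) ⟩
    a * 1#         ≈⟨ *-congˡ (sym yy⁻¹≈1) ⟩
    a * (y * y⁻¹)  ≈⟨ sym (*-assoc a y y⁻¹) ⟩
    (a * y) * y⁻¹  ≈⟨ *-congʳ ay≈0 ⟩
    0# * y⁻¹       ≈⟨ zeroˡ y⁻¹ ⟩
    0#             ∎

  Triangular : ∀ {r n} → (Fin r → Fin n → Carrier) → Set ℓ
  Triangular x = ∀ j → ∃[ v ] (¬ (x j v ≈ 0#) × (∀ i → i < j → x i v ≈ 0#))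

  triangular⇒independent : ∀ {r n} {x : Fin r → Fin n → Carrier} → Triangular x →
    ∀ (a : Fin r → Carrier) → (∀ v → ∑ K (λ j → a j * x j v) ≈ 0#) → ∀ j → a j ≈ 0#
  triangular⇒independent {x = x} triangular a combination≈0 j = go j (>-wellFounded j)
    where
    go : ∀ j → Acc _>_ j → a j ≈ 0#
    go j (acc later) with triangular j
    ... | v , xjv≉0 , earlier≈0 =
      *-cancelʳ-nonzero (a j) (x j v)
        (trans (sym (∑-single (λ i → a i * x i v) j others≈0)) (combination≈0 v)) xjv≉0
      where
      others≈0 : ∀ i → i ≢ j → a i * x i v ≈ 0#
      others≈0 i i≢j with <-cmp i j
      ... | tri< i<j _ _ = trans (*-congˡ (earlier≈0 i i<j)) (zeroʳ (a i))
      ... | tri≈ _ i≡j _ = contradiction i≡j i≢j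
      ... | tri> _ _ i>j = trans (*-congʳ (go i (later i>j))) (zeroˡ (x i v))

  straight⇒triangular : ∀ {n} (T : Graph n) (λ' : Carrier) {r} (x : Fin r → Fin n → Carrier) →
    IsStraight K T λ' x → Triangular x
  straight⇒triangular T λ' x (_ , _ , _ , _ , nonzero , vanishes) j with nonzero j
  ... | v , v∈Cj , xjv≉0 = v , xjv≉0 , λ i i<j → vanishes i j i<j v v∈Cj

mainTheorem16 : ∀ {c ℓ} (K : Field c ℓ) (n : ℕ) (T : Graph n) → IsTree T →
    (λ' : Field.Carrier K) → IsEigenvalue K T λ' →
    (r : ℕ) (x : Fin r → Fin n → Field.Carrier K) →
    IsStraight K T λ' x → LinearlyIndependent K T x
mainTheorem16 K n T _ λ' _ r x straight =
  triangular⇒independent K (straight⇒triangular K T λ' x straight)
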